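{- Let $\mathbf{pd}$ be the period-doubling word, $P_{\mathbf{pd}}(n)=\sum_{i=0}^{n-1}p_{\mathbf{pd}}(i)$ and $h_{\mathbf{pd}}(n)=P_{\mathbf{pd}}(n)/n$. Then for every integer $n\ge 1$, \[ \Big(\tfrac13\log_2 n-\tfrac1{18}\Big)n+\tfrac49 \le P_{\mathbf{pd}}(n)\le \Big(\tfrac43\log_2 n+\tfrac{22}{9}\Big)n+\tfrac59\] and \[ \tfrac13\log_2 n-\tfrac1{18}\le h_{\mathbf{pd}}(n)\le \tfrac43\log_2 n+3.\]
   Context: The period-doubling word $\mathbf{pd}=w_0w_1w_2\cdots$ is the infinite fixed point (starting with $0$) of the morphism $0\mapsto 01$, $1\mapsto 00$. For an infinite word $\mathbf w=w_0w_1w_2\cdots$, the periodicity function $p_{\mathbf w}(i)$ is the length of the shortest nonempty prefix $u$ of $w_iw_{i+1}w_{i+2}\cdots$ such that either $u$ is a suffix of $w_0\cdots w_{i-1}$ or $w_0\cdots w_{i-1}$ is a suffix of $u$ (for $i=0$, $w_0\cdots w_{i-1}$ is the empty word); if no such $u$ exists, $p_{\mathbf w}(i)=\infty$ (this does not occur for recurrent words such as $\mathbf{pd}$). -}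

module Defs where

open import Data.Bool using (Bool; true; false)
open import Data.Nat using (ℕ; zero; suc; _+_; _*_; _∸_; _^_; _≤_; _<_)
open import Data.List using (List; []; _∷_; _++_; concatMap; map; upTo)
open import Data.Nat.ListAction using (sum)
open import Data.Product using (_×_)
open import Data.Sum using (_⊎_)
open import Relation.Binary.PropositionalEquality using (_≡_)
open import Relation.Nullary using (¬_)

-- Letters: false = 0, true = 1.
Letter : Set
Letter = Bool

φ : Letter → List Letter
φ false = false ∷ true ∷ []
φ true  = false ∷ false ∷ []

φ* : List Letter → List Letter
φ* = concatMap φ

φpow : ℕ → List Letter
φpow zero    = false ∷ []
φpow (suc k) = φ* (φpow k)

-- i-th letter of a list (default false when out of range)
nth : List Letter → ℕ → Letter
nth []       _       = false
nth (x ∷ xs) zero    = x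
nth (x ∷ xs) (suc i) = nth xs i

-- The period-doubling word: w_i is the i-th letter of φ^(i+1)(0),
-- which has length 2^(i+1) > i and is a prefix of the fixed point.
pd : ℕ → Letter
pd i = nth (φpow (suc i)) i

-- For an infinite word w, position i and length m ≥ 1, u = w_i ⋯ w_{i+m-1}.
-- (1) u is a suffix of w_0 ⋯ w_{i-1}: m ≤ i and w_{i-m+j} = w_{i+j} for j < m.
-- (2) w_0 ⋯ w_{i-1} is a suffix of u: i ≤ m and w_j = w_{m+j} for j < i.
Condition : (ℕ → Letter) → ℕ → ℕ → Set
Condition w i m =
  (m ≤ i × (∀ j → j < m → w ((i ∸ m) + j) ≡ w (i + j)))
  ⊎ (i ≤ m × (∀ j → j < i → w j ≡ w (m + j)))

IsPeriodicity : (ℕ → Letter) → ℕ → ℕ → Set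
IsPeriodicity w i m =
  1 ≤ m × Condition w i m × (∀ m′ → 1 ≤ m′ → m′ < m → ¬ Condition w i m′)

Psum : (ℕ → ℕ) → ℕ → ℕ
Psum p n = sum (map p (upTo n))

module Submission where

-- Since φ(0) = 01 and φ(1) = 00, the word satisfies w(2j) = 0 and w(2j+1) = 1 - w(j). Hence a
-- length 2m satisfies the condition at position i exactly when m does at ⌊i/2⌋, an odd length
-- m ≥ 3 never does at i ≥ 2 (it would compare even and odd positions and force a factor 11),
-- and length 1 does exactly when w(i-1) = w(i). So p(i+1) is either 1 or 2 p(⌈i/2⌉), and
-- summing over the pairs 2j, 2j+1 gives 2P(n) + n ≤ P(2n) ≤ 2P(n) + 2n. Induction on k with
-- 2^k ≤ n < 2^(k+1) turns these into bounds linear in k n, and k ≤ log₂ n < k + 1.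

open import Defs
open import Data.Bool using (Bool; true; false; not; if_then_else_)
open import Data.Bool.Properties using (not-injective)
open import Data.Empty using (⊥; ⊥-elim)
open import Data.List using ([]; _∷_; [_]; _++_; _∷ʳ_; length; map; upTo)
open import Data.List.Properties using (applyUpTo-∷ʳ; map-++)
open import Data.Nat
  using (ℕ; zero; suc; _+_; _*_; _∸_; _^_; _≤_; _<_; z≤n; s≤s; s≤s⁻¹; z<s; s<s; ⌊_/2⌋; ⌈_/2⌉)
open import Data.Nat.Induction using (<-wellFounded; <-rec)
open import Data.Nat.ListAction using (sum)
open import Data.Nat.ListAction.Properties using (sum-++)
open import Data.Nat.Properties
open import Data.Nat.Tactic.RingSolver using (solve-∀)
open import Data.Product using (Σ; ∃-syntax; _×_; _,_; proj₁; proj₂; uncurry)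
open import Data.Sum using (inj₁; inj₂)
open import Function.Base using (id; _∘_)
open import Function.Bundles using (_⇔_; mk⇔; Equivalence)
open import Induction.WellFounded using (module FixPoint)
open import Relation.Binary.PropositionalEquality
  using (_≡_; refl; sym; trans; cong; cong₂; subst; subst₂; module ≡-Reasoning)
open import Relation.Nullary using (¬_; contradiction)

open Equivalence using (to; from)

double : ℕ → ℕ
double zero    = zero
double (suc n) = suc (suc (double n))

double≡2* : ∀ n → double n ≡ 2 * n
double≡2* zero    = refl
double≡2* (suc n) = trans (cong (suc ∘ suc) (double≡2* n)) (sym (*-suc 2 n))

n≤double : ∀ n → n ≤ double n
n≤double zero    = z≤n
n≤double (suc n) = s≤s (m≤n⇒m≤1+n (n≤double n))

double-mono-≤ : ∀ {m n} → m ≤ n → double m ≤ double n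
double-mono-≤ z≤n       = z≤n
double-mono-≤ (s≤s m≤n) = s≤s (s≤s (double-mono-≤ m≤n))

double-cancel-≤ : ∀ {m n} → double m ≤ double n → m ≤ n
double-cancel-≤ {zero}          _              = z≤n
double-cancel-≤ {suc m} {suc n} (s≤s (s≤s le)) = s≤s (double-cancel-≤ le)

double-cancel-< : ∀ {m n} → double m < double n → m < n
double-cancel-< {zero}  {suc n} _              = z<s
double-cancel-< {suc m} {suc n} (s≤s (s≤s lt)) = s<s (double-cancel-< lt)

double-cancel-≤-odd : ∀ {m n} → double m ≤ suc (double n) → m ≤ n
double-cancel-≤-odd le = s≤s⁻¹ (double-cancel-< (s≤s le))

double-cancel-<-odd : ∀ {m n} → suc (double m) < double n → m < n
double-cancel-<-odd lt = double-cancel-< (<⇒≤ lt)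

double-+ : ∀ m n → double m + double n ≡ double (m + n)
double-+ zero    n = refl
double-+ (suc m) n = cong (suc ∘ suc) (double-+ m n)

double-+-suc : ∀ m n → double m + suc (double n) ≡ suc (double (m + n))
double-+-suc m n = trans (+-suc (double m) (double n)) (cong suc (double-+ m n))

double-∸ : ∀ m n → double m ∸ double n ≡ double (m ∸ n)
double-∸ m       zero    = refl
double-∸ zero    (suc n) = refl
double-∸ (suc m) (suc n) = double-∸ m n

suc-double-∸ : ∀ {m n} → n ≤ m → suc (double m) ∸ double n ≡ suc (double (m ∸ n))
suc-double-∸ {m}     {zero}  _         = refl
suc-double-∸ {suc m} {suc n} (s≤s n≤m) = suc-double-∸ n≤m

⌊double/2⌋ : ∀ n → ⌊ double n /2⌋ ≡ n
⌊double/2⌋ zero    = refl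
⌊double/2⌋ (suc n) = cong suc (⌊double/2⌋ n)

⌊suc-double/2⌋ : ∀ n → ⌊ suc (double n) /2⌋ ≡ n
⌊suc-double/2⌋ zero    = refl
⌊suc-double/2⌋ (suc n) = cong suc (⌊suc-double/2⌋ n)

data EvenOrOdd : ℕ → Set where
  even : ∀ a → EvenOrOdd (double a)
  odd  : ∀ a → EvenOrOdd (suc (double a))

evenOrOdd : ∀ n → EvenOrOdd n
evenOrOdd zero = even zero
evenOrOdd (suc n) with evenOrOdd n
... | even a = odd a
... | odd a  = even (suc a)

n<2^n : ∀ n → n < 2 ^ n
n<2^n zero    = z<s
n<2^n (suc n) = ≤-<-trans (n<2^n n) (^-monoʳ-< 2 ≤-refl (n<1+n n))

pow2-bracket : ∀ n → 1 ≤ n → ∃[ k ] 2 ^ k ≤ n × n < 2 ^ suc k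
pow2-bracket (suc zero)    _ = 0 , ≤-refl , ≤-refl
pow2-bracket (suc (suc n)) _ with pow2-bracket (suc n) (s≤s z≤n)
... | k , lo , hi with m≤n⇒m<n∨m≡n hi
...   | inj₁ hi′ = k , m≤n⇒m≤1+n lo , hi′
...   | inj₂ eq  = suc k , ≤-reflexive (sym eq) ,
                   subst (_< 2 ^ suc (suc k)) (sym eq) (^-monoʳ-< 2 ≤-refl (n<1+n (suc k)))

pow2-bracket-even : ∀ k {m} → 2 ^ suc k ≤ double m → double m < 2 ^ suc (suc k) →
                    2 ^ k ≤ m × m < 2 ^ suc k
pow2-bracket-even k lo hi =
  double-cancel-≤ (≤-trans (≤-reflexive (double≡2* (2 ^ k))) lo) ,
  double-cancel-< (<-≤-trans hi (≤-reflexive (sym (double≡2* (2 ^ suc k)))))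

pow2-bracket-odd : ∀ k {m} → 2 ^ suc k ≤ suc (double m) → suc (double m) < 2 ^ suc (suc k) →
                   2 ^ k ≤ m × m < 2 ^ suc k
pow2-bracket-odd k lo hi =
  double-cancel-≤-odd (≤-trans (≤-reflexive (double≡2* (2 ^ k))) lo) ,
  double-cancel-<-odd (<-≤-trans hi (≤-reflexive (sym (double≡2* (2 ^ suc k)))))

length-φ* : ∀ xs → length (φ* xs) ≡ double (length xs)
length-φ* []           = refl
length-φ* (false ∷ xs) = cong (suc ∘ suc) (length-φ* xs)
length-φ* (true ∷ xs)  = cong (suc ∘ suc) (length-φ* xs)

length-φpow : ∀ k → length (φpow k) ≡ 2 ^ k
length-φpow zero    = refl
length-φpow (suc k) = begin
  length (φ* (φpow k))     ≡⟨ length-φ* (φpow k) ⟩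
  double (length (φpow k)) ≡⟨ cong double (length-φpow k) ⟩
  double (2 ^ k)           ≡⟨ double≡2* (2 ^ k) ⟩
  2 ^ suc k                ∎
  where open ≡-Reasoning

<-length-φpow : ∀ k → k < length (φpow k)
<-length-φpow k = subst (k <_) (sym (length-φpow k)) (n<2^n k)

nth-φ*-double : ∀ xs j → nth (φ* xs) (double j) ≡ false
nth-φ*-double []           j       = refl
nth-φ*-double (false ∷ xs) zero    = refl
nth-φ*-double (true ∷ xs)  zero    = refl
nth-φ*-double (false ∷ xs) (suc j) = nth-φ*-double xs j
nth-φ*-double (true ∷ xs)  (suc j) = nth-φ*-double xs j

nth-φ*-suc-double : ∀ xs j → j < length xs → nth (φ* xs) (suc (double j)) ≡ not (nth xs j)
nth-φ*-suc-double (false ∷ xs) zero    _         = refl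
nth-φ*-suc-double (true ∷ xs)  zero    _         = refl
nth-φ*-suc-double (false ∷ xs) (suc j) (s≤s j<) = nth-φ*-suc-double xs j j<
nth-φ*-suc-double (true ∷ xs)  (suc j) (s≤s j<) = nth-φ*-suc-double xs j j<

nth-φpow-suc : ∀ k i → i < length (φpow k) → nth (φpow (suc k)) i ≡ nth (φpow k) i
nth-φpow-suc zero    zero    _         = refl
nth-φpow-suc zero    (suc i) (s≤s ())
nth-φpow-suc (suc k) i       i< with evenOrOdd i
... | even j = trans (nth-φ*-double (φpow (suc k)) j) (sym (nth-φ*-double (φpow k) j))
... | odd j  = begin
  nth (φ* (φpow (suc k))) (suc (double j)) ≡⟨ nth-φ*-suc-double (φpow (suc k)) j j<′ ⟩
  not (nth (φpow (suc k)) j)               ≡⟨ cong not (nth-φpow-suc k j j<) ⟩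
  not (nth (φpow k) j)                     ≡⟨ sym (nth-φ*-suc-double (φpow k) j j<) ⟩
  nth (φ* (φpow k)) (suc (double j))       ∎
  where
  open ≡-Reasoning
  j< : j < length (φpow k)
  j< = double-cancel-<-odd (subst (suc (double j) <_) (length-φ* (φpow k)) i<)
  j<′ : j < length (φpow (suc k))
  j<′ = ≤-<-trans (m≤n⇒m≤1+n (n≤double j)) i<

nth-φpow≡pd : ∀ {i} k → i ≤ k → nth (φpow (suc k)) i ≡ pd i
nth-φpow≡pd zero    z≤n = refl
nth-φpow≡pd {i} (suc k) i≤1+k with m≤n⇒m<n∨m≡n i≤1+k
... | inj₂ refl   = refl
... | inj₁ i<1+k = trans (nth-φpow-suc (suc k) i (<-trans i<1+k (<-length-φpow (suc k))))
                         (nth-φpow≡pd k (s≤s⁻¹ i<1+k))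

pd-double : ∀ n → pd (double n) ≡ false
pd-double n = nth-φ*-double (φpow (double n)) n

pd-suc-double : ∀ n → pd (suc (double n)) ≡ not (pd n)
pd-suc-double n = begin
  nth (φ* (φpow (suc (double n)))) (suc (double n)) ≡⟨ nth-φ*-suc-double (φpow (suc (double n))) n n< ⟩
  not (nth (φpow (suc (double n))) n)               ≡⟨ cong not (nth-φpow≡pd (double n) (n≤double n)) ⟩
  not (pd n)                                        ∎
  where
  open ≡-Reasoning
  n< : n < length (φpow (suc (double n)))
  n< = ≤-<-trans (m≤n⇒m≤1+n (n≤double n)) (<-length-φpow (suc (double n)))

pd-no-11 : ∀ n → pd n ≡ true → pd (suc n) ≡ true → ⊥
pd-no-11 n with evenOrOdd n
... | even a = λ e _ → contradiction (trans (sym (pd-double a)) e) λ ()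
... | odd a  = λ _ e → contradiction (trans (sym (pd-double (suc a))) e) λ ()

-- Condition w i m unfolds to  (m ≤ i × SameFactor w (i ∸ m) i m) ⊎ (i ≤ m × SameFactor w 0 m i).
SameFactor : (ℕ → Letter) → ℕ → ℕ → ℕ → Set
SameFactor w x y L = ∀ t → t < L → w (x + t) ≡ w (y + t)

pd-double-+-double : ∀ x s → pd (double x + double s) ≡ false
pd-double-+-double x s = trans (cong pd (double-+ x s)) (pd-double (x + s))

pd-double-+-odd : ∀ x s → pd (double x + suc (double s)) ≡ not (pd (x + s))
pd-double-+-odd x s = trans (cong pd (double-+-suc x s)) (pd-suc-double (x + s))

pd-odd-+-double : ∀ x s → pd (suc (double x) + double s) ≡ not (pd (x + s))
pd-odd-+-double x s = trans (cong (pd ∘ suc) (double-+ x s)) (pd-suc-double (x + s))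

pd-odd-+-odd : ∀ x s → pd (suc (double x) + suc (double s)) ≡ false
pd-odd-+-odd x s = trans (cong (pd ∘ suc) (double-+-suc x s)) (pd-double (suc (x + s)))

sameFactor-double : ∀ x y L {L′} → L′ ≤ suc (double L) → SameFactor pd x y L →
                    SameFactor pd (double x) (double y) L′
sameFactor-double x y L L′≤ h t t< with evenOrOdd t
... | even s = trans (pd-double-+-double x s) (sym (pd-double-+-double y s))
... | odd s  = trans (pd-double-+-odd x s) (trans (cong not (h s s<L)) (sym (pd-double-+-odd y s)))
  where
  s<L : s < L
  s<L = double-cancel-< (s≤s⁻¹ (<-≤-trans t< L′≤))

sameFactor-double-odd : ∀ x y L → SameFactor pd x y L →
                        SameFactor pd (suc (double x)) (suc (double y)) (double L)
sameFactor-double-odd x y L h t t< with evenOrOdd t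
... | even s = trans (pd-odd-+-double x s)
                 (trans (cong not (h s (double-cancel-< t<))) (sym (pd-odd-+-double y s)))
... | odd s  = trans (pd-odd-+-odd x s) (sym (pd-odd-+-odd y s))

sameFactor-halve : ∀ x y L {L′} → double L ≤ L′ → SameFactor pd (double x) (double y) L′ →
                   SameFactor pd x y L
sameFactor-halve x y L {L′} 2L≤ h s s<L = not-injective
  (trans (sym (pd-double-+-odd x s)) (trans (h (suc (double s)) t<) (pd-double-+-odd y s)))
  where
  t< : suc (double s) < L′
  t< = ≤-trans (double-mono-≤ s<L) 2L≤

sameFactor-halve-odd : ∀ x y L → SameFactor pd (suc (double x)) (suc (double y)) (double L) →
                       SameFactor pd x y L
sameFactor-halve-odd x y L h s s<L = not-injective
  (trans (sym (pd-odd-+-double x s)) (trans (h (double s) t<) (pd-odd-+-double y s)))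
  where
  t< : double s < double L
  t< = <⇒≤ (double-mono-≤ s<L)

condition-double-even : ∀ a m → Condition pd (double a) (double m) ⇔ Condition pd a m
condition-double-even a m = mk⇔ halve double′
  where
  halve : Condition pd (double a) (double m) → Condition pd a m
  halve (inj₁ (m≤a , h)) = inj₁ (double-cancel-≤ m≤a , sameFactor-halve (a ∸ m) a m ≤-refl
    (subst (λ x → SameFactor pd x (double a) (double m)) (double-∸ a m) h))
  halve (inj₂ (a≤m , h)) = inj₂ (double-cancel-≤ a≤m , sameFactor-halve 0 m a ≤-refl h)
  double′ : Condition pd a m → Condition pd (double a) (double m)
  double′ (inj₁ (m≤a , h)) = inj₁ (double-mono-≤ m≤a ,
    subst (λ x → SameFactor pd x (double a) (double m)) (sym (double-∸ a m))
      (sameFactor-double (a ∸ m) a m (n≤1+n _) h))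
  double′ (inj₂ (a≤m , h)) = inj₂ (double-mono-≤ a≤m , sameFactor-double 0 m a (n≤1+n _) h)

condition-double-odd : ∀ a m → Condition pd (suc (double a)) (double m) ⇔ Condition pd a m
condition-double-odd a m = mk⇔ halve double′
  where
  halve : Condition pd (suc (double a)) (double m) → Condition pd a m
  halve (inj₁ (2m≤ , h)) = inj₁ (m≤a , sameFactor-halve-odd (a ∸ m) a m
    (subst (λ x → SameFactor pd x (suc (double a)) (double m)) (suc-double-∸ m≤a) h))
    where
    m≤a : m ≤ a
    m≤a = double-cancel-≤-odd 2m≤
  halve (inj₂ (≤2m , h)) = inj₂ (double-cancel-≤ (≤-trans (n≤1+n _) ≤2m) ,
    sameFactor-halve 0 m a (n≤1+n _) h)
  double-short : m ≤ a → SameFactor pd (a ∸ m) a m → Condition pd (suc (double a)) (double m)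
  double-short m≤a h = inj₁ (≤-trans (double-mono-≤ m≤a) (n≤1+n _) ,
    subst (λ x → SameFactor pd x (suc (double a)) (double m)) (sym (suc-double-∸ m≤a))
      (sameFactor-double-odd (a ∸ m) a m h))
  double′ : Condition pd a m → Condition pd (suc (double a)) (double m)
  double′ (inj₁ (m≤a , h)) = double-short m≤a h
  double′ (inj₂ (a≤m , h)) with m≤n⇒m<n∨m≡n a≤m
  ... | inj₁ a<m  = inj₂ (<⇒≤ (double-mono-≤ a<m) , sameFactor-double 0 m a ≤-refl h)
  ... | inj₂ refl = double-short ≤-refl (subst (λ x → SameFactor pd x a a) (sym (n∸n≡0 a)) h)

condition-double : ∀ i m → Condition pd i (double m) ⇔ Condition pd ⌊ i /2⌋ m
condition-double i m with evenOrOdd i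
... | even a rewrite ⌊double/2⌋ a     = condition-double-even a m
... | odd a  rewrite ⌊suc-double/2⌋ a = condition-double-odd a m

false≡not⇒true : ∀ {b} → false ≡ not b → b ≡ true
false≡not⇒true {true} _ = refl

false≡not⇔true : ∀ b → false ≡ not b ⇔ b ≡ true
false≡not⇔true b = mk⇔ false≡not⇒true λ { refl → refl }

not≡false⇔true : ∀ b → not b ≡ false ⇔ b ≡ true
not≡false⇔true b = mk⇔ (false≡not⇒true ∘ sym) λ { refl → refl }

-- Agreement at both offsets forces w(c) = w(c+1) = 1, since even positions carry 0.
pd-parity-mismatch : ∀ a c → pd (double a) ≡ pd (suc (double c)) →
                     pd (2 + double a) ≡ pd (2 + suc (double c)) → ⊥
pd-parity-mismatch a c e₀ e₂ = pd-no-11 c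
  (false≡not⇒true (trans (sym (pd-double a)) (trans e₀ (pd-suc-double c))))
  (false≡not⇒true (trans (sym (pd-double (suc a))) (trans e₂ (pd-suc-double (suc c)))))

pd-no-odd-shift : ∀ x b → pd x ≡ pd (x + suc (double b)) →
                  pd (2 + x) ≡ pd (2 + (x + suc (double b))) → ⊥
pd-no-odd-shift x b with evenOrOdd x
... | even a rewrite double-+-suc a b = pd-parity-mismatch a (a + b)
... | odd a  rewrite double-+-suc a b = λ e₀ e₂ → pd-parity-mismatch (suc (a + b)) a (sym e₀) (sym e₂)

odd-length-not-condition : ∀ {i} b → 2 ≤ i → ¬ Condition pd i (suc (double (suc b)))
odd-length-not-condition {i} b _ (inj₁ (m≤i , h)) =
  pd-no-odd-shift (i ∸ m) (suc b) (at 0 z<s) (at 2 (s≤s (s≤s z<s)))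
  where
  m : ℕ
  m = suc (double (suc b))
  at : ∀ t → t < m → pd (t + (i ∸ m)) ≡ pd (t + (i ∸ m + m))
  at t t<m = begin
    pd (t + (i ∸ m))     ≡⟨ cong pd (+-comm t (i ∸ m)) ⟩
    pd (i ∸ m + t)       ≡⟨ h t t<m ⟩
    pd (i + t)           ≡⟨ cong pd (+-comm i t) ⟩
    pd (t + i)           ≡⟨ cong (λ z → pd (t + z)) (sym (m∸n+n≡m m≤i)) ⟩
    pd (t + (i ∸ m + m)) ∎
    where open ≡-Reasoning
odd-length-not-condition b 2≤i (inj₂ (_ , h)) = contradiction
  (trans (sym (pd-double (suc (suc b)))) (trans (cong pd (+-comm 1 (suc (double (suc b))))) (sym (h 1 2≤i))))
  λ ()

pd-repeat⇔ : ∀ i → pd i ≡ pd (suc i) ⇔ pd ⌊ i /2⌋ ≡ true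
pd-repeat⇔ i with evenOrOdd i
... | even a rewrite ⌊double/2⌋ a     | pd-double a     | pd-suc-double a   = false≡not⇔true (pd a)
... | odd a  rewrite ⌊suc-double/2⌋ a | pd-suc-double a | pd-double (suc a) = not≡false⇔true (pd a)

condition-1⇔ : ∀ i → Condition pd (suc i) 1 ⇔ pd i ≡ pd (suc i)
condition-1⇔ i = mk⇔ repeat condition
  where
  repeat : Condition pd (suc i) 1 → pd i ≡ pd (suc i)
  repeat (inj₁ (_ , h))       = subst₂ (λ u v → pd u ≡ pd v) (+-identityʳ i) (+-identityʳ (suc i)) (h 0 z<s)
  repeat (inj₂ (s≤s z≤n , h)) = h 0 z<s
  condition : pd i ≡ pd (suc i) → Condition pd (suc i) 1
  condition e = inj₁ (s≤s z≤n , λ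
    { zero    _        → subst₂ (λ u v → pd u ≡ pd v) (sym (+-identityʳ i)) (sym (+-identityʳ (suc i))) e
    ; (suc _) (s≤s ()) })

-- p(i+1) is 1 when w_i = w_(i+1), which by pd-repeat⇔ means w_⌊i/2⌋ = 1, and 2 p(⌈i/2⌉) otherwise.
period-step : ∀ i → (∀ {j} → j < i → ℕ) → ℕ
period-step zero    _   = 1
period-step (suc i) rec = if pd ⌊ i /2⌋ then 1 else 2 * rec (⌊n/2⌋<n i)

period : ℕ → ℕ
period = <-rec (λ _ → ℕ) period-step

period-step-ext : ∀ i {rec rec′ : ∀ {j} → j < i → ℕ} →
                  (∀ {j} (j<i : j < i) → rec j<i ≡ rec′ j<i) →
                  period-step i rec ≡ period-step i rec′
period-step-ext zero    _  = refl
period-step-ext (suc i) eq = cong (λ q → if pd ⌊ i /2⌋ then 1 else 2 * q) (eq (⌊n/2⌋<n i))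

period-unfold : ∀ i → period i ≡ period-step i (λ {j} _ → period j)
period-unfold i = FixPoint.unfold-wfRec <-wellFounded (λ _ → ℕ) period-step period-step-ext {i}

period-zero : period 0 ≡ 1
period-zero = period-unfold 0

period-suc : ∀ i → period (suc i) ≡ (if pd ⌊ i /2⌋ then 1 else 2 * period ⌈ i /2⌉)
period-suc i = period-unfold (suc i)

period-one : period 1 ≡ 2
period-one = trans (period-suc 0) (cong (2 *_) period-zero)

period-suc-double : ∀ n → period (suc (double n)) ≡ (if pd n then 1 else 2 * period n)
period-suc-double n = trans (period-suc (double n))
  (cong₂ (λ j k → if pd j then 1 else 2 * period k) (⌊double/2⌋ n) (⌊suc-double/2⌋ n))

period-double-suc : ∀ n → period (double (suc n)) ≡ (if pd n then 1 else 2 * period (suc n))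
period-double-suc n = trans (period-suc (suc (double n)))
  (cong₂ (λ j k → if pd j then 1 else 2 * period k) (⌊suc-double/2⌋ n) (cong suc (⌊double/2⌋ n)))

period-suc-at : ∀ i {b} → pd ⌊ i /2⌋ ≡ b → period (suc i) ≡ (if b then 1 else 2 * period ⌈ i /2⌉)
period-suc-at i e = trans (period-suc i) (cong (λ b → if b then 1 else 2 * period ⌈ i /2⌉) e)

period-suc-repeat : ∀ n → pd n ≡ pd (suc n) → period (suc n) ≡ 1
period-suc-repeat n e = period-suc-at n (to (pd-repeat⇔ n) e)

isPeriodicity-1 : ∀ {w i} → Condition w i 1 → IsPeriodicity w i 1
isPeriodicity-1 c = ≤-refl , c , λ _ 1≤m′ m′<1 _ → <⇒≱ m′<1 1≤m′

isPeriodicity-double : ∀ {i q} → 2 ≤ i → ¬ Condition pd i 1 → IsPeriodicity pd ⌊ i /2⌋ q →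
                       IsPeriodicity pd i (2 * q)
isPeriodicity-double {i} {q} 2≤i ¬c₁ (1≤q , c , minimal) = subst (IsPeriodicity pd i) (double≡2* q)
  (≤-trans (s≤s z≤n) (double-mono-≤ 1≤q) , from (condition-double i q) c , minimal′)
  where
  minimal′ : ∀ m′ → 1 ≤ m′ → m′ < double q → ¬ Condition pd i m′
  minimal′ m′ 1≤m′ m′<2q c′ with evenOrOdd m′
  minimal′ _ () _ _ | even zero
  ... | even (suc b) = minimal (suc b) (s≤s z≤n) (double-cancel-< m′<2q) (to (condition-double i (suc b)) c′)
  ... | odd zero     = ¬c₁ c′
  ... | odd (suc b)  = odd-length-not-condition b 2≤i c′

-- Position 1 is not covered by isPeriodicity-double: the condition holds there for length 3.
isPeriodicity-pd-1 : IsPeriodicity pd 1 2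
isPeriodicity-pd-1 = s≤s z≤n , inj₂ (s≤s z≤n , λ { zero _ → refl ; (suc _) (s≤s ()) }) , minimal
  where
  minimal : ∀ m′ → 1 ≤ m′ → m′ < 2 → ¬ Condition pd 1 m′
  minimal (suc zero)    _ _ c = contradiction (to (condition-1⇔ 0) c) λ ()
  minimal (suc (suc _)) _ (s≤s (s≤s ()))

period-isPeriodicity : ∀ i → IsPeriodicity pd i (period i)
period-isPeriodicity = <-rec _ go
  where
  go : ∀ i → (∀ {j} → j < i → IsPeriodicity pd j (period j)) → IsPeriodicity pd i (period i)
  go zero          _   = subst (IsPeriodicity pd 0) (sym period-zero) (isPeriodicity-1 (inj₂ (z≤n , λ _ ())))
  go (suc zero)    _   = subst (IsPeriodicity pd 1) (sym period-one) isPeriodicity-pd-1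
  go (suc (suc i)) rec = by-letter (pd ⌊ suc i /2⌋) refl
    where
    by-letter : ∀ b → pd ⌊ suc i /2⌋ ≡ b → IsPeriodicity pd (suc (suc i)) (period (suc (suc i)))
    by-letter true  e = subst (IsPeriodicity pd (suc (suc i))) (sym (period-suc-at (suc i) e))
      (isPeriodicity-1 (from (condition-1⇔ (suc i)) (from (pd-repeat⇔ (suc i)) e)))
    by-letter false e = subst (IsPeriodicity pd (suc (suc i))) (sym (period-suc-at (suc i) e))
      (isPeriodicity-double (s≤s (s≤s z≤n)) ¬c₁ (rec (⌊n/2⌋<n (suc i))))
      where
      ¬c₁ : ¬ Condition pd (suc (suc i)) 1
      ¬c₁ c = contradiction (trans (sym e) (to (pd-repeat⇔ (suc i)) (to (condition-1⇔ (suc i)) c))) λ ()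

period-positive : ∀ n → 1 ≤ period n
period-positive n = proj₁ (period-isPeriodicity n)

pair-bounds : ∀ (a b : Bool) {P x y} → 1 ≤ P →
              x ≡ (if a then 1 else 2 * P) → y ≡ (if b then 1 else 2 * P) →
              (a ≡ true → b ≡ true → ⊥) → (a ≡ false → b ≡ false → P ≡ 1) →
              (2 * P + 1 ≤ x + y) × (x + y ≤ 2 * P + 2) × (x ≤ 2 * P)
pair-bounds true  true  _   _    _    no-11 _ = ⊥-elim (no-11 refl refl)
pair-bounds true  false {P} 1≤P refl refl _ _ =
  ≤-reflexive (+-comm (2 * P) 1) , ≤-trans (≤-reflexive (+-comm 1 (2 * P))) (+-monoʳ-≤ (2 * P) (n≤1+n 1)) ,
  ≤-trans 1≤P (m≤n*m P 2)
pair-bounds false true  {P} _   refl refl _ _ = ≤-refl , +-monoʳ-≤ (2 * P) (n≤1+n 1) , ≤-refl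
pair-bounds false false     _   refl refl _ P≡1 with P≡1 refl refl
... | refl = n≤1+n 3 , ≤-refl , ≤-refl

period-pair : ∀ n → (2 * period n + 1 ≤ period (double n) + period (suc (double n))) ×
                    (period (double n) + period (suc (double n)) ≤ 2 * period n + 2) ×
                    (period (double n) ≤ 2 * period n)
period-pair zero    = pair-bounds true false (period-positive 0) period-zero (period-suc 0) (λ _ ()) (λ ())
period-pair (suc n) = pair-bounds (pd n) (pd (suc n)) (period-positive (suc n))
  (period-double-suc n) (period-suc-double (suc n)) (pd-no-11 n)
  λ e₁ e₂ → period-suc-repeat n (trans e₁ (sym e₂))

Psum-suc : ∀ p n → Psum p (suc n) ≡ Psum p n + p n
Psum-suc p n = begin
  sum (map p (upTo (suc n)))      ≡⟨ cong (sum ∘ map p) (sym (applyUpTo-∷ʳ id n)) ⟩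
  sum (map p (upTo n ∷ʳ n))       ≡⟨ cong sum (map-++ p (upTo n) [ n ]) ⟩
  sum (map p (upTo n) ++ [ p n ]) ≡⟨ sum-++ (map p (upTo n)) [ p n ] ⟩
  Psum p n + (p n + 0)            ≡⟨ cong (Psum p n +_) (+-identityʳ (p n)) ⟩
  Psum p n + p n                  ∎
  where open ≡-Reasoning

lower-step-even : ∀ k m A T {n} → n ≡ 2 * m →
                  8 + suc k * (6 * m) ≤ 18 * A + m → 2 * A + m ≤ T →
                  8 + suc (suc k) * (6 * n) ≤ 18 * T + n
lower-step-even k m A T refl ih rec = begin
  8 + suc (suc k) * (6 * (2 * m))    ≤⟨ m+n≤o⇒m≤o _ (≤-reflexive (e₁ k m)) ⟩
  2 * (8 + suc k * (6 * m)) + 12 * m ≤⟨ +-monoˡ-≤ (12 * m) (*-monoʳ-≤ 2 ih) ⟩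
  2 * (18 * A + m) + 12 * m          ≤⟨ m+n≤o⇒m≤o _ (≤-reflexive (e₂ A m)) ⟩
  18 * (2 * A + m) + 2 * m           ≤⟨ +-monoˡ-≤ (2 * m) (*-monoʳ-≤ 18 rec) ⟩
  18 * T + 2 * m                     ∎
  where
  open ≤-Reasoning
  e₁ : ∀ k m → 8 + suc (suc k) * (6 * (2 * m)) + 8 ≡ 2 * (8 + suc k * (6 * m)) + 12 * m
  e₁ = solve-∀
  e₂ : ∀ A m → 2 * (18 * A + m) + 12 * m + 6 * m ≡ 18 * (2 * A + m) + 2 * m
  e₂ = solve-∀

lower-step-odd : ∀ k m A T {n} → n ≡ 1 + 2 * m → k ≤ m →
                 8 + suc k * (6 * m) ≤ 18 * A + m → 2 * A + m + 1 ≤ T →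
                 8 + suc (suc k) * (6 * n) ≤ 18 * T + n
lower-step-odd k m A T refl k≤m ih rec = begin
  8 + suc (suc k) * (6 * (1 + 2 * m))            ≡⟨ e₁ k m ⟩
  2 * (8 + suc k * (6 * m)) + 12 * m + 6 * k + 4 ≤⟨ +-monoˡ-≤ 4 (+-monoˡ-≤ (6 * k) (+-monoˡ-≤ (12 * m) 2ih)) ⟩
  2 * (18 * A + m) + 12 * m + 6 * k + 4          ≤⟨ +-monoˡ-≤ 4 (+-monoʳ-≤ (2 * (18 * A + m) + 12 * m) 6k≤6m) ⟩
  2 * (18 * A + m) + 12 * m + 6 * m + 4          ≤⟨ m+n≤o⇒m≤o _ (≤-reflexive (e₂ A m)) ⟩
  18 * (2 * A + m + 1) + (1 + 2 * m)             ≤⟨ +-monoˡ-≤ (1 + 2 * m) (*-monoʳ-≤ 18 rec) ⟩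
  18 * T + (1 + 2 * m)                           ∎
  where
  open ≤-Reasoning
  e₁ : ∀ k m → 8 + suc (suc k) * (6 * (1 + 2 * m)) ≡ 2 * (8 + suc k * (6 * m)) + 12 * m + 6 * k + 4
  e₁ = solve-∀
  e₂ : ∀ A m → 2 * (18 * A + m) + 12 * m + 6 * m + 4 + 15 ≡ 18 * (2 * A + m + 1) + (1 + 2 * m)
  e₂ = solve-∀
  2ih : 2 * (8 + suc k * (6 * m)) ≤ 2 * (18 * A + m)
  2ih = *-monoʳ-≤ 2 ih
  6k≤6m : 6 * k ≤ 6 * m
  6k≤6m = *-monoʳ-≤ 6 k≤m

9*[2*B+2*x] : ∀ B x → 9 * (2 * B + 2 * x) ≡ 2 * (9 * B) + 18 * x
9*[2*B+2*x] = solve-∀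

upper-step-even : ∀ k m B U {n} → n ≡ 2 * m → 1 ≤ m →
                  9 * B ≤ (22 * m + 5) + k * (12 * m) → U ≤ 2 * B + 2 * m →
                  9 * U ≤ (22 * n + 5) + suc k * (12 * n)
upper-step-even k (suc m) B U refl _ ih rec = begin
  9 * U                                              ≤⟨ *-monoʳ-≤ 9 rec ⟩
  9 * (2 * B + 2 * suc m)                            ≡⟨ 9*[2*B+2*x] B (suc m) ⟩
  2 * (9 * B) + 18 * suc m                           ≤⟨ +-monoˡ-≤ (18 * suc m) (*-monoʳ-≤ 2 ih) ⟩
  2 * ((22 * suc m + 5) + k * (12 * suc m)) + 18 * suc m ≤⟨ m+n≤o⇒m≤o _ (≤-reflexive (e k m)) ⟩
  (22 * (2 * suc m) + 5) + suc k * (12 * (2 * suc m)) ∎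
  where
  open ≤-Reasoning
  e : ∀ k m → 2 * ((22 * suc m + 5) + k * (12 * suc m)) + 18 * suc m + (6 * m + 1)
              ≡ (22 * (2 * suc m) + 5) + suc k * (12 * (2 * suc m))
  e = solve-∀

upper-step-odd : ∀ k m B U {n} → n ≡ 1 + 2 * m →
                 9 * B ≤ (22 * m + 5) + k * (12 * m) → U ≤ 2 * B + 2 * suc m →
                 9 * U ≤ (22 * n + 5) + suc k * (12 * n)
upper-step-odd k m B U refl ih rec = begin
  9 * U                                          ≤⟨ *-monoʳ-≤ 9 rec ⟩
  9 * (2 * B + 2 * suc m)                        ≡⟨ 9*[2*B+2*x] B (suc m) ⟩
  2 * (9 * B) + 18 * suc m                       ≤⟨ +-monoˡ-≤ (18 * suc m) (*-monoʳ-≤ 2 ih) ⟩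
  2 * ((22 * m + 5) + k * (12 * m)) + 18 * suc m ≤⟨ m+n≤o⇒m≤o _ (≤-reflexive (e k m)) ⟩
  (22 * (1 + 2 * m) + 5) + suc k * (12 * (1 + 2 * m)) ∎
  where
  open ≤-Reasoning
  e : ∀ k m → 2 * ((22 * m + 5) + k * (12 * m)) + 18 * suc m + (6 * m + 12 * k + 11)
              ≡ (22 * (1 + 2 * m) + 5) + suc k * (12 * (1 + 2 * m))
  e = solve-∀

module DoublingSums
  (p : ℕ → ℕ)
  (p-positive : ∀ n → 1 ≤ p n)
  (p₀ : p 0 ≡ 1) (p₁ : p 1 ≡ 2)
  (pair-lower : ∀ n → 2 * p n + 1 ≤ p (double n) + p (suc (double n)))
  (pair-upper : ∀ n → p (double n) + p (suc (double n)) ≤ 2 * p n + 2)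
  (even-upper : ∀ n → p (double n) ≤ 2 * p n)
  where

  open ≤-Reasoning

  P : ℕ → ℕ
  P = Psum p

  P-double-suc : ∀ n → P (double (suc n)) ≡ P (double n) + (p (double n) + p (suc (double n)))
  P-double-suc n = begin-equality
    P (suc (suc (double n)))                           ≡⟨ Psum-suc p (suc (double n)) ⟩
    P (suc (double n)) + p (suc (double n))            ≡⟨ cong (_+ p (suc (double n))) (Psum-suc p (double n)) ⟩
    P (double n) + p (double n) + p (suc (double n))   ≡⟨ +-assoc (P (double n)) _ _ ⟩
    P (double n) + (p (double n) + p (suc (double n))) ∎

  P-double-lower : ∀ n → 2 * P n + n ≤ P (double n)
  P-double-lower zero    = z≤n
  P-double-lower (suc n) = begin
    2 * P (suc n) + suc n                              ≡⟨ cong (λ s → 2 * s + suc n) (Psum-suc p n) ⟩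
    2 * (P n + p n) + suc n                            ≡⟨ e (P n) (p n) n ⟩
    (2 * P n + n) + (2 * p n + 1)                      ≤⟨ +-mono-≤ (P-double-lower n) (pair-lower n) ⟩
    P (double n) + (p (double n) + p (suc (double n))) ≡⟨ sym (P-double-suc n) ⟩
    P (double (suc n))                                 ∎
    where
    e : ∀ a b n → 2 * (a + b) + suc n ≡ (2 * a + n) + (2 * b + 1)
    e = solve-∀

  P-double-upper : ∀ n → P (double n) ≤ 2 * P n + 2 * n
  P-double-upper zero    = z≤n
  P-double-upper (suc n) = begin
    P (double (suc n))                                 ≡⟨ P-double-suc n ⟩
    P (double n) + (p (double n) + p (suc (double n))) ≤⟨ +-mono-≤ (P-double-upper n) (pair-upper n) ⟩
    (2 * P n + 2 * n) + (2 * p n + 2)                  ≡⟨ e (P n) (p n) n ⟩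
    2 * (P n + p n) + 2 * suc n                        ≡⟨ cong (λ s → 2 * s + 2 * suc n) (Psum-suc p n) ⟨
    2 * P (suc n) + 2 * suc n                          ∎
    where
    e : ∀ a b n → (2 * a + 2 * n) + (2 * b + 2) ≡ 2 * (a + b) + 2 * suc n
    e = solve-∀

  P-odd-lower : ∀ n → 2 * P n + n + 1 ≤ P (suc (double n))
  P-odd-lower n = subst (2 * P n + n + 1 ≤_) (sym (Psum-suc p (double n)))
    (+-mono-≤ (P-double-lower n) (p-positive (double n)))

  P-odd-upper : ∀ n → P (suc (double n)) ≤ 2 * P (suc n) + 2 * n
  P-odd-upper n = begin
    P (suc (double n))          ≡⟨ Psum-suc p (double n) ⟩
    P (double n) + p (double n) ≤⟨ +-mono-≤ (P-double-upper n) (even-upper n) ⟩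
    (2 * P n + 2 * n) + 2 * p n ≡⟨ e (P n) (p n) n ⟩
    2 * (P n + p n) + 2 * n     ≡⟨ cong (λ s → 2 * s + 2 * n) (sym (Psum-suc p n)) ⟩
    2 * P (suc n) + 2 * n       ∎
    where
    e : ∀ a b n → (2 * a + 2 * n) + 2 * b ≡ 2 * (a + b) + 2 * n
    e = solve-∀

  lower-bound : ∀ k n → 2 ^ k ≤ n → n < 2 ^ suc k → 8 + suc k * (6 * n) ≤ 18 * P n + n
  lower-bound zero    (suc zero)    _ _ rewrite p₀ = m≤m+n 14 5
  lower-bound zero    (suc (suc n)) _ (s≤s (s≤s ()))
  lower-bound (suc k) n lo hi with evenOrOdd n
  ... | even m = lower-step-even k m (P m) (P (double m)) (double≡2* m)
                   (uncurry (lower-bound k m) (pow2-bracket-even k lo hi)) (P-double-lower m)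
  ... | odd m  = lower-step-odd k m (P m) (P (suc (double m))) (cong suc (double≡2* m))
                   (<⇒≤ (<-≤-trans (n<2^n k) (proj₁ bracket)))
                   (uncurry (lower-bound k m) bracket) (P-odd-lower m)
    where
    bracket : 2 ^ k ≤ m × m < 2 ^ suc k
    bracket = pow2-bracket-odd k lo hi

  upper-bound : ∀ k n → 2 ^ k ≤ n → n < 2 ^ suc k → 9 * P (suc n) ≤ (22 * n + 5) + k * (12 * n)
  upper-bound zero    (suc zero)    _ _ rewrite p₀ | p₁ = ≤-refl
  upper-bound zero    (suc (suc n)) _ (s≤s (s≤s ()))
  upper-bound (suc k) n lo hi with evenOrOdd n
  ... | even m = upper-step-even k m (P (suc m)) (P (suc (double m))) (double≡2* m)
                   (≤-trans (m^n>0 2 k) (proj₁ bracket))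
                   (uncurry (upper-bound k m) bracket) (P-odd-upper m)
    where
    bracket : 2 ^ k ≤ m × m < 2 ^ suc k
    bracket = pow2-bracket-even k lo hi
  ... | odd m  = upper-step-odd k m (P (suc m)) (P (double (suc m))) (cong suc (double≡2* m))
                   (uncurry (upper-bound k m) (pow2-bracket-odd k lo hi)) (P-double-upper (suc m))

2^a*n^c≤2^e : ∀ {n} a k c {e} → n < 2 ^ suc k → a + suc k * c ≤ e → 2 ^ a * n ^ c ≤ 2 ^ e
2^a*n^c≤2^e {n} a k c {e} n< le = begin
  2 ^ a * n ^ c           ≤⟨ *-monoʳ-≤ (2 ^ a) (^-monoˡ-≤ c (<⇒≤ n<)) ⟩
  2 ^ a * (2 ^ suc k) ^ c ≡⟨ cong (2 ^ a *_) (^-*-assoc 2 (suc k) c) ⟩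
  2 ^ a * 2 ^ (suc k * c) ≡⟨ sym (^-distribˡ-+-* 2 a (suc k * c)) ⟩
  2 ^ (a + suc k * c)     ≤⟨ ^-monoʳ-≤ 2 le ⟩
  2 ^ e                   ∎
  where open ≤-Reasoning

2^[a∸b]≤n^c : ∀ {n} k a b c → 2 ^ k ≤ n → a ≤ b + k * c → 2 ^ (a ∸ b) ≤ n ^ c
2^[a∸b]≤n^c {n} k a b c 2^k≤n le = begin
  2 ^ (a ∸ b) ≤⟨ ^-monoʳ-≤ 2 (m≤n+o⇒m∸n≤o a b le) ⟩
  2 ^ (k * c) ≡⟨ sym (^-*-assoc 2 k c) ⟩
  (2 ^ k) ^ c ≤⟨ ^-monoˡ-≤ c 2^k≤n ⟩
  n ^ c       ∎
  where open ≤-Reasoning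

third-of-upper-bound : ∀ {n} k Q → 1 ≤ n → 9 * Q ≤ (22 * n + 5) + k * (12 * n) →
                       3 * Q ≤ 9 * n + k * (4 * n)
third-of-upper-bound {suc n} k Q _ le = *-cancelˡ-≤ 3 (begin
  3 * (3 * Q)                                 ≡⟨ e₁ Q ⟩
  9 * Q                                       ≤⟨ le ⟩
  (22 * suc n + 5) + k * (12 * suc n)         ≤⟨ m+n≤o⇒m≤o _ (≤-reflexive (e₂ n k)) ⟩
  3 * (9 * suc n + k * (4 * suc n))           ∎)
  where
  open ≤-Reasoning
  e₁ : ∀ Q → 3 * (3 * Q) ≡ 9 * Q
  e₁ = solve-∀
  e₂ : ∀ n k → (22 * suc n + 5) + k * (12 * suc n) + 5 * n ≡ 3 * (9 * suc n + k * (4 * suc n))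
  e₂ = solve-∀

open DoublingSums period period-positive period-zero period-one
  (proj₁ ∘ period-pair) (proj₁ ∘ proj₂ ∘ period-pair) (proj₂ ∘ proj₂ ∘ period-pair)

Psum-period-bounds : ∀ n → 1 ≤ n →
  ((2 ^ 8) * (n ^ (6 * n)) ≤ 2 ^ (18 * Psum period n + n)) ×
  (2 ^ (9 * Psum period n ∸ (22 * n + 5)) ≤ n ^ (12 * n)) ×
  (n ^ (6 * n) ≤ 2 ^ (18 * Psum period n + n)) ×
  (2 ^ (3 * Psum period n ∸ 9 * n) ≤ n ^ (4 * n))
Psum-period-bounds n 1≤n with pow2-bracket n 1≤n
... | k , 2^k≤n , n<2^k+1 =
  lower , 2^[a∸b]≤n^c k (9 * P n) (22 * n + 5) (12 * n) 2^k≤n 9P≤ ,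
  ≤-trans (m≤n*m _ (2 ^ 8)) lower ,
  2^[a∸b]≤n^c k (3 * P n) (9 * n) (4 * n) 2^k≤n (third-of-upper-bound k (P n) 1≤n 9P≤)
  where
  lower : 2 ^ 8 * n ^ (6 * n) ≤ 2 ^ (18 * P n + n)
  lower = 2^a*n^c≤2^e 8 k (6 * n) n<2^k+1 (lower-bound k n 2^k≤n n<2^k+1)
  9P≤ : 9 * P n ≤ (22 * n + 5) + k * (12 * n)
  9P≤ = ≤-trans (*-monoʳ-≤ 9 (subst (P n ≤_) (sym (Psum-suc period n)) (m≤m+n (P n) (period n))))
                (upper-bound k n 2^k≤n n<2^k+1)

theorem7 : Σ (ℕ → ℕ) λ p →
             (∀ i → IsPeriodicity pd i (p i)) ×
             (∀ n → 1 ≤ n →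
                ((2 ^ 8) * (n ^ (6 * n)) ≤ 2 ^ (18 * Psum p n + n)) ×
                (2 ^ (9 * Psum p n ∸ (22 * n + 5)) ≤ n ^ (12 * n)) ×
                (n ^ (6 * n) ≤ 2 ^ (18 * Psum p n + n)) ×
                (2 ^ (3 * Psum p n ∸ 9 * n) ≤ n ^ (4 * n)))
theorem7 = period , period-isPeriodicity , Psum-period-bounds
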